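{- Let $2\le n_1<\cdots<n_m$, $t_1,\dots,t_m\ge1$, $t=\sum t_i$, $N=\prod n_i^{t_i}$, $G=K_{n_1}^{t_1}\square\cdots\square K_{n_m}^{t_m}$, and let $O=(v^1,\dots,v^N)$ be an ordering of $V(G)$ that induces a consecutive radio labeling of $G$. Then for every integer $k\ge0$ and every $i\ge1$ with $i+k+1\le N$, $$\alpha_{k+1}^i\ge\alpha_k^i-\sum_{b=1}^k b.$$
   Context: $K_n$ is the complete graph on $\{v_1,\dots,v_n\}$; $\square$ is the Cartesian product and $H^s$ the $s$-fold Cartesian power. Vertices of $G$ are $t$-tuples $(x_1,\dots,x_t)$ whose first $t_1$ entries lie in $V(K_{n_1})$, next $t_2$ in $V(K_{n_2})$, etc.; distance is the number of differing coordinates, $\mathrm{diam}(G)=t$. Write $v^i=(v^i_1,\dots,v^i_t)$. An ordering is a list of all vertices without repetition; a radio labeling of $H$ is $f:V(H)\to\mathbb{Z}^+$ with $|f(u)-f(v)|\ge\mathrm{diam}(H)+1-d(u,v)$ for distinct $u,v$, consecutive if bijective onto $\{1,\dots,|V(H)|\}$; the labeling induced by an ordering is $f(v^1)=1$, $f(v^i)=\min\{x\in\mathbb{Z}:x>f(v^{i-1}),\ |x-f(v^j)|\ge\mathrm{diam}+1-d(v^i,v^j)\ \forall j<i\}$. For $i\ge1$, $k\ge0$ with $i+k\le N$, $\alpha_k^i$ is the number of column indices $j\in\{1,\dots,t\}$ such that $v^i_j,v^{i+1}_j,\dots,v^{i+k}_j$ are pairwise distinct. -}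

module Defs where

open import Data.Nat using (ℕ; zero; suc; _+_; _*_; _∸_; _^_; _≤_; _<_; ∣_-_∣)
open import Data.Fin using (Fin; toℕ; _≟_)
open import Data.List using (List; map; filter; length; take; drop; upTo)
open import Data.Nat.ListAction using (sum; product)
open import Data.List.Base using (allFin)
open import Data.List.Relation.Unary.Unique.Propositional using (Unique)
open import Data.List.Relation.Unary.AllPairs using (allPairs?)
open import Data.Product using (Σ; ∃; _×_)
open import Relation.Binary.PropositionalEquality using (_≡_; _≢_)
open import Relation.Nullary using (¬?)
open import Relation.Nullary.Decidable using (Dec)

-- Parameters of G = K_{n_0}^{t_0} □ ... □ K_{n_{m-1}}^{t_{m-1}} (0-based block index b : Fin m).
-- A vertex assigns to every column (b , r), r : Fin (t b), an entry in V(K_{n b}) = Fin (n b).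
Vertex : (m : ℕ) (n t : Fin m → ℕ) → Set
Vertex m n t = (b : Fin m) → Fin (t b) → Fin (n b)

_≈V_ : {m : ℕ} {n t : Fin m → ℕ} → Vertex m n t → Vertex m n t → Set
_≈V_ {m} {n} {t} u v = ∀ (b : Fin m) (r : Fin (t b)) → u b r ≡ v b r

-- t = Σ t_b  (= diam G)
totalT : (m : ℕ) (t : Fin m → ℕ) → ℕ
totalT m t = sum (map t (allFin m))

numV : (m : ℕ) (n t : Fin m → ℕ) → ℕ
numV m n t = product (map (λ b → n b ^ t b) (allFin m))

dist : {m : ℕ} {n t : Fin m → ℕ} → Vertex m n t → Vertex m n t → ℕ
dist {m} {n} {t} u v =
  sum (map (λ b → length (filter (λ r → ¬? (u b r ≟ v b r)) (allFin (t b)))) (allFin m))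

-- an ordering O = (v^1,...,v^N): a list of all vertices without repetition,
-- given as O : Fin N → Vertex, injective and surjective (position a ↦ v^{a+1})
IsOrdering : (m : ℕ) (n t : Fin m → ℕ) → (Fin (numV m n t) → Vertex m n t) → Set
IsOrdering m n t O =
  (∀ a c → O a ≈V O c → a ≡ c) × (∀ (v : Vertex m n t) → ∃ λ a → O a ≈V v)

-- a labeling f of the vertices, given via positions in O: f a = f(v^{a+1}).
-- radio condition: |f(u)-f(v)| ≥ diam + 1 - d(u,v) for distinct u, v
IsRadio : (m : ℕ) (n t : Fin m → ℕ) → (Fin (numV m n t) → Vertex m n t) →
          (Fin (numV m n t) → ℕ) → Set
IsRadio m n t O f =
  (∀ a → 1 ≤ f a) ×
  (∀ a c → a ≢ c → totalT m t + 1 ∸ dist (O a) (O c) ≤ ∣ f a - f c ∣)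

IsConsecutive : (m : ℕ) (n t : Fin m → ℕ) → (Fin (numV m n t) → ℕ) → Set
IsConsecutive m n t f =
  (∀ a → 1 ≤ f a × f a ≤ numV m n t) ×
  (∀ a c → f a ≡ f c → a ≡ c) ×
  (∀ x → 1 ≤ x → x ≤ numV m n t → ∃ λ a → f a ≡ x)

-- f is the labeling induced by O:
-- f(v^1) = 1, and f(v^i) = min { x > f(v^{i-1}) : |x - f(v^j)| ≥ diam + 1 - d(v^i,v^j) ∀ j < i }
Admissible : (m : ℕ) (n t : Fin m → ℕ) → (Fin (numV m n t) → Vertex m n t) →
             (Fin (numV m n t) → ℕ) → (prev cur : Fin (numV m n t)) → ℕ → Set
Admissible m n t O f prev cur x =
  f prev < x ×
  (∀ j → toℕ j < toℕ cur → totalT m t + 1 ∸ dist (O cur) (O j) ≤ ∣ x - f j ∣)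

IsInduced : (m : ℕ) (n t : Fin m → ℕ) → (Fin (numV m n t) → Vertex m n t) →
            (Fin (numV m n t) → ℕ) → Set
IsInduced m n t O f =
  (∀ a → toℕ a ≡ 0 → f a ≡ 1) ×
  (∀ prev cur → toℕ cur ≡ suc (toℕ prev) →
     Admissible m n t O f prev cur (f cur) ×
     (∀ x → Admissible m n t O f prev cur x → f cur ≤ x))

InducesConsecutiveRadio : (m : ℕ) (n t : Fin m → ℕ) → (Fin (numV m n t) → Vertex m n t) → Set
InducesConsecutiveRadio m n t O =
  ∃ λ f → IsInduced m n t O f × IsRadio m n t O f × IsConsecutive m n t f

-- the list v^{i+1}, ..., v^{i+k+1} (0-based start position i, k+1 entries)
segment : (m : ℕ) (n t : Fin m → ℕ) → (Fin (numV m n t) → Vertex m n t) →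
          (k i : ℕ) → List (Vertex m n t)
segment m n t O k i = take (suc k) (drop i (map O (allFin (numV m n t))))

-- α_k at 0-based position i (paper's α_k^{i+1}): number of columns (b , r) such that
-- the entries of v^{i+1},...,v^{i+k+1} in that column are pairwise distinct
α : (m : ℕ) (n t : Fin m → ℕ) → (Fin (numV m n t) → Vertex m n t) → (k i : ℕ) → ℕ
α m n t O k i =
  sum (map (λ b → length (filter
         (λ r → allPairs? (λ x y → ¬? (x ≟ y)) (map (λ v → v b r) (segment m n t O k i)))
         (allFin (t b))))
       (allFin m))

triangle : ℕ → ℕ
triangle k = sum (upTo (suc k))

-- Appending v^{i+k+2} to the window v^{i+1}, …, v^{i+k+1} can only spoil distinctness in
-- a column where the new vertex agrees with some vertex of the window, so α drops by at most
-- the total number of such agreements. A consecutive labelling induced by an ordering is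
-- f(vʲ) = j, and then the radio condition says that vertices at distance g + 1 in the
-- ordering agree in at most g columns; summed over the window this is at most 0 + 1 + ⋯ + k.
module Submission where

open import Defs
open import Data.Nat using (ℕ; suc; _+_; _∸_; _≤_; _<_)
open import Data.Fin using (Fin)
open import Data.Fin as F using ()

open import Data.Bool using (true; false)
open import Data.Fin using (toℕ; fromℕ<; _≟_)
open import Data.Fin.Properties using (toℕ-fromℕ<; toℕ<n; toℕ-injective)
open import Data.List using (List; []; _∷_; [_]; _++_; _∷ʳ_; map; filter; length; take; drop; tabulate; allFin; upTo)
open import Data.List.Properties using (map-cong; map-tabulate; map-++; length-tabulate; upTo-∷ʳ)
open import Data.List.Relation.Unary.All as All using (All; []; _∷_)
open import Data.List.Relation.Unary.AllPairs using (AllPairs; allPairs?; []; _∷_)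
import Data.List.Relation.Unary.AllPairs.Properties as AllPairs
open import Data.Nat using (zero; _*_; z≤n; s≤s; s≤s⁻¹; ∣_-_∣)
open import Data.Nat.ListAction using (sum)
open import Data.Nat.ListAction.Properties using (sum-++)
open import Data.Nat.Properties hiding (_≟_)
open import Algebra.Properties.CommutativeSemigroup +-commutativeSemigroup using (interchange)
open import Data.Product using (_,_; proj₁; proj₂)
open import Function using (_∘_; id)
open import Relation.Binary.Definitions using (DecidableEquality)
open import Relation.Binary.PropositionalEquality hiding ([_])
open import Relation.Nullary using (Dec; _because_; ¬_; ¬?; invert; contradiction)
open import Relation.Unary using (Decidable)

indicator : ∀ {p} {P : Set p} → Dec P → ℕ
indicator (true because _) = 1
indicator (false because _) = 0

indicator+indicator-¬≡1 : ∀ {p} {P : Set p} (d : Dec P) → indicator d + indicator (¬? d) ≡ 1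
indicator+indicator-¬≡1 (true because _) = refl
indicator+indicator-¬≡1 (false because _) = refl

toℕ≡+⇒< : ∀ {N i j} (a : Fin N) → toℕ a ≡ i + j → i < N
toℕ≡+⇒< {i = i} {j} a a≡i+j = ≤-<-trans (m≤m+n i j) (subst (_< _) a≡i+j (toℕ<n a))

module _ {a} {A : Set a} where

  length-filter≡sum-indicator : ∀ {p} {P : A → Set p} (P? : Decidable P) xs →
    length (filter P? xs) ≡ sum (map (indicator ∘ P?) xs)
  length-filter≡sum-indicator P? [] = refl
  length-filter≡sum-indicator P? (x ∷ xs) with P? x
  ... | true because _ = cong suc (length-filter≡sum-indicator P? xs)
  ... | false because _ = length-filter≡sum-indicator P? xs

  sum-map-mono : ∀ {f g : A → ℕ} → (∀ x → f x ≤ g x) → ∀ xs → sum (map f xs) ≤ sum (map g xs)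
  sum-map-mono f≤g [] = z≤n
  sum-map-mono f≤g (x ∷ xs) = +-mono-≤ (f≤g x) (sum-map-mono f≤g xs)

  sum-map-+ : ∀ (f g : A → ℕ) xs →
    sum (map (λ x → f x + g x) xs) ≡ sum (map f xs) + sum (map g xs)
  sum-map-+ f g [] = refl
  sum-map-+ f g (x ∷ xs) = trans (cong (f x + g x +_) (sum-map-+ f g xs)) (interchange (f x) (g x) _ _)

  sum-map-const : ∀ c xs → sum (map (λ (_ : A) → c) xs) ≡ length xs * c
  sum-map-const c [] = refl
  sum-map-const c (x ∷ xs) = cong (c +_) (sum-map-const c xs)

  drop-tabulate : ∀ {N} (g : Fin N → A) (a : Fin N) {i} → toℕ a ≡ i →
    drop i (tabulate g) ≡ g a ∷ drop (suc i) (tabulate g)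
  drop-tabulate g F.zero refl = refl
  drop-tabulate g (F.suc a) refl = drop-tabulate (g ∘ F.suc) a refl

  take-suc-drop-tabulate : ∀ {N} (g : Fin N → A) (a : Fin N) k {i} → toℕ a ≡ i + k →
    take (suc k) (drop i (tabulate g)) ≡ take k (drop i (tabulate g)) ∷ʳ g a
  take-suc-drop-tabulate g a zero {i} a≡i+0 =
    cong (take 1) (drop-tabulate g a (trans a≡i+0 (+-identityʳ i)))
  take-suc-drop-tabulate {N} g a (suc k) {i} a≡i+1+k = begin
    take (suc (suc k)) (drop i T)           ≡⟨ cong (take (suc (suc k))) drop-at-i ⟩
    g c ∷ take (suc k) (drop (suc i) T)     ≡⟨ cong (g c ∷_) (take-suc-drop-tabulate g a k (trans a≡i+1+k (+-suc i k))) ⟩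
    g c ∷ (take k (drop (suc i) T) ∷ʳ g a)  ≡⟨ cong (λ xs → take (suc k) xs ∷ʳ g a) (sym drop-at-i) ⟩
    take (suc k) (drop i T) ∷ʳ g a          ∎
    where
    open ≡-Reasoning
    T : List A
    T = tabulate g
    i<N : i < N
    i<N = toℕ≡+⇒< a a≡i+1+k
    c : Fin N
    c = fromℕ< i<N
    drop-at-i : drop i T ≡ g c ∷ drop (suc i) T
    drop-at-i = drop-tabulate g c (toℕ-fromℕ< i<N)

module _ {a} {A : Set a} (_≟ᴬ_ : DecidableEquality A) where

  Distinct : List A → Set a
  Distinct = AllPairs (λ x y → ¬ x ≡ y)

  distinct? : Decidable Distinct
  distinct? = allPairs? (λ x y → ¬? (x ≟ᴬ y))

  count : A → List A → ℕ
  count x ys = sum (map (λ y → indicator (x ≟ᴬ y)) ys)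

  count≡0⇒All≢ : ∀ x ys → count x ys ≡ 0 → All (λ y → ¬ y ≡ x) ys
  count≡0⇒All≢ x [] _ = []
  count≡0⇒All≢ x (y ∷ ys) count≡0 with x ≟ᴬ y
  ... | true because _ = contradiction count≡0 1+n≢0
  ... | false because [x≢y] = (invert [x≢y] ∘ sym) ∷ count≡0⇒All≢ x ys count≡0

  distinct-∷ʳ : ∀ x ys → Distinct ys → count x ys ≡ 0 → Distinct (ys ∷ʳ x)
  distinct-∷ʳ x ys ys! count≡0 =
    AllPairs.++⁺ ys! ([] ∷ []) (All.map (_∷ []) (count≡0⇒All≢ x ys count≡0))

  indicator-distinct≤indicator-distinct-∷ʳ+count : ∀ x ys →
    indicator (distinct? ys) ≤ indicator (distinct? (ys ∷ʳ x)) + count x ys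
  indicator-distinct≤indicator-distinct-∷ʳ+count x ys with distinct? ys
  ... | false because _ = z≤n
  ... | true because [ys!] with distinct? (ys ∷ʳ x)
  ...   | true because _ = s≤s z≤n
  ...   | false because [¬ys∷ʳx!] =
          n≢0⇒n>0 (invert [¬ys∷ʳx!] ∘ distinct-∷ʳ x ys (invert [ys!]))

triangle-suc : ∀ k → triangle (suc k) ≡ suc k + triangle k
triangle-suc k = begin
  sum (upTo (suc (suc k)))         ≡⟨ cong sum (sym (upTo-∷ʳ (suc k))) ⟩
  sum (upTo (suc k) ++ [ suc k ])  ≡⟨ sum-++ (upTo (suc k)) [ suc k ] ⟩
  triangle k + (suc k + 0)         ≡⟨ cong (triangle k +_) (+-identityʳ (suc k)) ⟩
  triangle k + suc k               ≡⟨ +-comm (triangle k) (suc k) ⟩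
  suc k + triangle k               ∎
  where open ≡-Reasoning

module _ {N} (f : Fin N → ℕ) (increasing : ∀ a c → toℕ c ≡ suc (toℕ a) → f a < f c) where

  increasing⇒f+d≤f : ∀ d a c → toℕ c ≡ toℕ a + d → f a + d ≤ f c
  increasing⇒f+d≤f zero a c c≡a+0 =
    ≤-reflexive (trans (+-identityʳ (f a)) (cong f (toℕ-injective (sym (trans c≡a+0 (+-identityʳ _))))))
  increasing⇒f+d≤f (suc d) a c c≡a+1+d = begin
    f a + suc d    ≡⟨ +-suc (f a) d ⟩
    suc (f a + d)  ≤⟨ s≤s (increasing⇒f+d≤f d a b (toℕ-fromℕ< a+d<N)) ⟩
    suc (f b)      ≤⟨ increasing b c (trans c≡a+1+d (trans (+-suc (toℕ a) d) (cong suc (sym (toℕ-fromℕ< a+d<N))))) ⟩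
    f c            ∎
    where
    open ≤-Reasoning
    a+d<N : toℕ a + d < N
    a+d<N = subst (_≤ N) (trans c≡a+1+d (+-suc (toℕ a) d)) (<⇒≤ (toℕ<n c))
    b : Fin N
    b = fromℕ< a+d<N

  increasing-from-1-bounded⇒≡suc-toℕ : (∀ a → toℕ a ≡ 0 → f a ≡ 1) → (∀ a → f a ≤ N) →
    ∀ a → f a ≡ suc (toℕ a)
  increasing-from-1-bounded⇒≡suc-toℕ starts-at-1 bounded a = ≤-antisym upper lower
    where
    0<N : 0 < N
    0<N = toℕ≡+⇒< a refl
    first : Fin N
    first = fromℕ< 0<N
    lower : suc (toℕ a) ≤ f a
    lower = subst (λ x → x + toℕ a ≤ f a) (starts-at-1 first (toℕ-fromℕ< 0<N))
              (increasing⇒f+d≤f (toℕ a) first a (cong (_+ toℕ a) (sym (toℕ-fromℕ< 0<N))))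
    d : ℕ
    d = N ∸ suc (toℕ a)
    1+a+d≡N : suc (toℕ a) + d ≡ N
    1+a+d≡N = m+[n∸m]≡n (toℕ<n a)
    a+d<N : toℕ a + d < N
    a+d<N = ≤-reflexive 1+a+d≡N
    upper : f a ≤ suc (toℕ a)
    upper = +-cancelʳ-≤ d (f a) (suc (toℕ a)) (begin
      f a + d           ≤⟨ increasing⇒f+d≤f d a (fromℕ< a+d<N) (toℕ-fromℕ< a+d<N) ⟩
      f (fromℕ< a+d<N)  ≤⟨ bounded (fromℕ< a+d<N) ⟩
      N                 ≡⟨ 1+a+d≡N ⟨
      suc (toℕ a) + d   ∎)
      where open ≤-Reasoning

module Columns (m : ℕ) (n t : Fin m → ℕ) where

  columnSum : ((b : Fin m) → Fin (t b) → ℕ) → ℕ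
  columnSum h = sum (map (λ b → sum (map (h b) (allFin (t b)))) (allFin m))

  columnSum-cong : ∀ {h g} → (∀ b r → h b r ≡ g b r) → columnSum h ≡ columnSum g
  columnSum-cong h≡g = cong sum (map-cong (λ b → cong sum (map-cong (h≡g b) (allFin (t b)))) (allFin m))

  columnSum-mono : ∀ {h g} → (∀ b r → h b r ≤ g b r) → columnSum h ≤ columnSum g
  columnSum-mono h≤g = sum-map-mono (λ b → sum-map-mono (h≤g b) (allFin (t b))) (allFin m)

  columnSum-+ : ∀ h g → columnSum (λ b r → h b r + g b r) ≡ columnSum h + columnSum g
  columnSum-+ h g = trans (cong sum (map-cong (λ b → sum-map-+ (h b) (g b) (allFin (t b))) (allFin m)))
                          (sum-map-+ _ _ (allFin m))

  columnSum-0 : columnSum (λ _ _ → 0) ≡ 0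
  columnSum-0 = trans (cong sum (map-cong (λ b → sum-map-0 (allFin (t b))) (allFin m))) (sum-map-0 (allFin m))
    where
    sum-map-0 : ∀ {A : Set} (xs : List A) → sum (map (λ _ → 0) xs) ≡ 0
    sum-map-0 xs = trans (sum-map-const 0 xs) (*-zeroʳ (length xs))

  columnSum-1 : columnSum (λ _ _ → 1) ≡ totalT m t
  columnSum-1 = cong sum (map-cong columnCount (allFin m))
    where
    columnCount : ∀ b → sum (map (λ _ → 1) (allFin (t b))) ≡ t b
    columnCount b = trans (sum-map-const 1 (allFin (t b))) (trans (*-identityʳ _) (length-tabulate id))

  sum-length-filter≡columnSum : ∀ {p} {P : (b : Fin m) → Fin (t b) → Set p} (P? : ∀ b → Decidable (P b)) →
    sum (map (λ b → length (filter (P? b) (allFin (t b)))) (allFin m)) ≡ columnSum (λ b r → indicator (P? b r))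
  sum-length-filter≡columnSum P? =
    cong sum (map-cong (λ b → length-filter≡sum-indicator (P? b) (allFin (t b))) (allFin m))

  column : (b : Fin m) (r : Fin (t b)) → List (Vertex m n t) → List (Fin (n b))
  column b r = map (λ v → v b r)

  agree : Vertex m n t → Vertex m n t → ℕ
  agree u v = columnSum (λ b r → indicator (u b r ≟ v b r))

  agree+dist≡totalT : ∀ u v → agree u v + dist u v ≡ totalT m t
  agree+dist≡totalT u v = begin
    agree u v + dist u v
      ≡⟨ cong (agree u v +_) (sum-length-filter≡columnSum (λ b r → ¬? (u b r ≟ v b r))) ⟩
    agree u v + columnSum (λ b r → indicator (¬? (u b r ≟ v b r)))
      ≡⟨ columnSum-+ _ _ ⟨
    columnSum (λ b r → indicator (u b r ≟ v b r) + indicator (¬? (u b r ≟ v b r)))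
      ≡⟨ columnSum-cong (λ b r → indicator+indicator-¬≡1 (u b r ≟ v b r)) ⟩
    columnSum (λ _ _ → 1)
      ≡⟨ columnSum-1 ⟩
    totalT m t ∎
    where open ≡-Reasoning

  columnSum-count≡sum-agree : ∀ w us →
    columnSum (λ b r → count _≟_ (w b r) (column b r us)) ≡ sum (map (agree w) us)
  columnSum-count≡sum-agree w [] = columnSum-0
  columnSum-count≡sum-agree w (u ∷ us) =
    trans (columnSum-+ _ _) (cong (agree w u +_) (columnSum-count≡sum-agree w us))

module Windows (m : ℕ) (n t : Fin m → ℕ) (O : Fin (numV m n t) → Vertex m n t) where

  open Columns m n t

  private
    N = numV m n t
    segment′ = segment m n t O
    α′ = α m n t O

  segment≡∷ : ∀ k {i} (a : Fin N) → toℕ a ≡ i →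
    segment′ k i ≡ O a ∷ take k (drop (suc i) (map O (allFin N)))
  segment≡∷ k {i} a a≡i =
    subst (λ L → take (suc k) (drop i L) ≡ O a ∷ take k (drop (suc i) L))
          (sym (map-tabulate id O)) (cong (take (suc k)) (drop-tabulate O a a≡i))

  segment-∷ʳ : ∀ k {i} (a : Fin N) → toℕ a ≡ i + suc k → segment′ (suc k) i ≡ segment′ k i ∷ʳ O a
  segment-∷ʳ k {i} a a≡i+1+k =
    subst (λ L → take (suc (suc k)) (drop i L) ≡ take (suc k) (drop i L) ∷ʳ O a)
          (sym (map-tabulate id O)) (take-suc-drop-tabulate O a (suc k) a≡i+1+k)

  α≡columnSum : ∀ k i → α′ k i ≡ columnSum (λ b r → indicator (distinct? _≟_ (column b r (segment′ k i))))
  α≡columnSum k i = sum-length-filter≡columnSum _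

  α≤α-suc+sum-agree : ∀ k i (a : Fin N) → toℕ a ≡ i + suc k →
    α′ k i ≤ α′ (suc k) i + sum (map (agree (O a)) (segment′ k i))
  α≤α-suc+sum-agree k i a a≡i+1+k = begin
    α′ k i
      ≡⟨ α≡columnSum k i ⟩
    columnSum (λ b r → indicator (distinct? _≟_ (column b r window)))
      ≤⟨ columnSum-mono (λ b r → indicator-distinct≤indicator-distinct-∷ʳ+count _≟_ (w b r) (column b r window)) ⟩
    columnSum (λ b r → indicator (distinct? _≟_ (column b r window ∷ʳ w b r)) + count _≟_ (w b r) (column b r window))
      ≡⟨ columnSum-+ _ _ ⟩
    columnSum (λ b r → indicator (distinct? _≟_ (column b r window ∷ʳ w b r)))
      + columnSum (λ b r → count _≟_ (w b r) (column b r window))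
      ≡⟨ cong₂ _+_ (sym α-suc≡columnSum) (columnSum-count≡sum-agree w window) ⟩
    α′ (suc k) i + sum (map (agree w) window) ∎
    where
    open ≤-Reasoning
    w : Vertex m n t
    w = O a
    window : List (Vertex m n t)
    window = segment′ k i
    α-suc≡columnSum : α′ (suc k) i ≡ columnSum (λ b r → indicator (distinct? _≟_ (column b r window ∷ʳ w b r)))
    α-suc≡columnSum = trans (α≡columnSum (suc k) i) (columnSum-cong λ b r →
      cong (indicator ∘ distinct? _≟_) (trans (cong (column b r) (segment-∷ʳ k a a≡i+1+k)) (map-++ _ window [ w ])))

module Radio (m : ℕ) (n t : Fin m → ℕ) (O : Fin (numV m n t) → Vertex m n t)
             (f : Fin (numV m n t) → ℕ) (radio : IsRadio m n t O f) where

  open Columns m n t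
  open Windows m n t O

  agree<∣f-f∣ : ∀ a c → a ≢ c → agree (O a) (O c) < ∣ f a - f c ∣
  agree<∣f-f∣ a c a≢c = begin
    suc (agree u v)                        ≡⟨ m+n∸n≡m (suc (agree u v)) (dist u v) ⟨
    suc (agree u v + dist u v) ∸ dist u v  ≡⟨ cong (λ x → suc x ∸ dist u v) (agree+dist≡totalT u v) ⟩
    suc (totalT m t) ∸ dist u v            ≡⟨ cong (_∸ dist u v) (+-comm 1 (totalT m t)) ⟩
    totalT m t + 1 ∸ dist u v              ≤⟨ proj₂ radio a c a≢c ⟩
    ∣ f a - f c ∣                          ∎
    where
    open ≤-Reasoning
    u v : Vertex m n t
    u = O a
    v = O c

  module _ (f≡suc-toℕ : ∀ a → f a ≡ suc (toℕ a)) where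

    agree≤gap : ∀ a c g → toℕ a ≡ toℕ c + suc g → agree (O a) (O c) ≤ g
    agree≤gap a c g a≡c+1+g = s≤s⁻¹ (subst (agree (O a) (O c) <_) ∣f-f∣≡1+g (agree<∣f-f∣ a c a≢c))
      where
      a≢c : a ≢ c
      a≢c refl = m≢1+m+n (toℕ c) (trans a≡c+1+g (+-suc (toℕ c) g))
      ∣f-f∣≡1+g : ∣ f a - f c ∣ ≡ suc g
      ∣f-f∣≡1+g = begin
        ∣ f a - f c ∣                   ≡⟨ cong₂ ∣_-_∣ (f≡suc-toℕ a) (f≡suc-toℕ c) ⟩
        ∣ toℕ a - toℕ c ∣               ≡⟨ cong (∣_- toℕ c ∣) a≡c+1+g ⟩
        ∣ toℕ c + suc g - toℕ c ∣       ≡⟨ ∣-∣-comm (toℕ c + suc g) (toℕ c) ⟩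
        ∣ toℕ c - toℕ c + suc g ∣       ≡⟨ ∣m-m+n∣≡n (toℕ c) (suc g) ⟩
        suc g                           ∎
        where open ≡-Reasoning

    sum-agree-segment≤+tail : ∀ k {i} (a : Fin (numV m n t)) → toℕ a ≡ i + suc k →
      sum (map (agree (O a)) (segment m n t O k i))
        ≤ k + sum (map (agree (O a)) (take k (drop (suc i) (map O (allFin _)))))
    sum-agree-segment≤+tail k {i} a a≡i+1+k = begin
      sum (map (agree (O a)) (segment m n t O k i))
        ≡⟨ cong (sum ∘ map (agree (O a))) (segment≡∷ k c (toℕ-fromℕ< i<N)) ⟩
      agree (O a) (O c) + sum (map (agree (O a)) (take k (drop (suc i) (map O (allFin _)))))
        ≤⟨ +-monoˡ-≤ _ (agree≤gap a c k a≡c+1+k) ⟩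
      k + sum (map (agree (O a)) (take k (drop (suc i) (map O (allFin _))))) ∎
      where
      open ≤-Reasoning
      i<N : i < numV m n t
      i<N = toℕ≡+⇒< a a≡i+1+k
      c : Fin (numV m n t)
      c = fromℕ< i<N
      a≡c+1+k : toℕ a ≡ toℕ c + suc k
      a≡c+1+k = trans a≡i+1+k (cong (_+ suc k) (sym (toℕ-fromℕ< i<N)))

    sum-agree≤triangle : ∀ k {i} (a : Fin (numV m n t)) → toℕ a ≡ i + suc k →
      sum (map (agree (O a)) (segment m n t O k i)) ≤ triangle k
    sum-agree≤triangle zero a a≡i+1 = sum-agree-segment≤+tail zero a a≡i+1
    sum-agree≤triangle (suc k) {i} a a≡i+2+k = begin
      sum (map (agree (O a)) (segment m n t O (suc k) i))
        ≤⟨ sum-agree-segment≤+tail (suc k) a a≡i+2+k ⟩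
      suc k + sum (map (agree (O a)) (segment m n t O k (suc i)))
        ≤⟨ +-monoʳ-≤ (suc k) (sum-agree≤triangle k {suc i} a (trans a≡i+2+k (+-suc i (suc k)))) ⟩
      suc k + triangle k
        ≡⟨ triangle-suc k ⟨
      triangle (suc k) ∎
      where open ≤-Reasoning

induced-consecutive⇒f≡suc-toℕ : ∀ m (n t : Fin m → ℕ) O f →
  IsInduced m n t O f → IsConsecutive m n t f → ∀ a → f a ≡ suc (toℕ a)
induced-consecutive⇒f≡suc-toℕ m n t O f (starts-at-1 , next) (bounds , _) =
  increasing-from-1-bounded⇒≡suc-toℕ f (λ a c c≡1+a → proj₁ (proj₁ (next a c c≡1+a)))
    starts-at-1 (proj₂ ∘ bounds)

-- Only the radio condition and f(vʲ) = j are used: neither the shape of G nor the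
-- bijectivity of O plays a role.
proposition14 : (m : ℕ) (n t : Fin m → ℕ) →
    1 ≤ m →
    (∀ b → 2 ≤ n b) →
    (∀ b c → b F.< c → n b < n c) →
    (∀ b → 1 ≤ t b) →
    (O : Fin (numV m n t) → Vertex m n t) →
    IsOrdering m n t O →
    InducesConsecutiveRadio m n t O →
    (k i : ℕ) → i + k + 1 < numV m n t →
    α m n t O k i ∸ triangle k ≤ α m n t O (suc k) i
proposition14 m n t _ _ _ _ O _ (f , induced , radio , consecutive) k i i+k+1<N =
  m≤n+o⇒m∸n≤o (α m n t O k i) (triangle k) (begin
    α m n t O k i
      ≤⟨ α≤α-suc+sum-agree k i a a≡i+1+k ⟩
    α m n t O (suc k) i + sum (map (agree (O a)) (segment m n t O k i))
      ≤⟨ +-monoʳ-≤ _ (sum-agree≤triangle f≡suc-toℕ k a a≡i+1+k) ⟩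
    α m n t O (suc k) i + triangle k
      ≡⟨ +-comm _ (triangle k) ⟩
    triangle k + α m n t O (suc k) i ∎)
  where
  open ≤-Reasoning
  open Columns m n t
  open Windows m n t O
  open Radio m n t O f radio
  f≡suc-toℕ : ∀ a → f a ≡ suc (toℕ a)
  f≡suc-toℕ = induced-consecutive⇒f≡suc-toℕ m n t O f induced consecutive
  a : Fin (numV m n t)
  a = fromℕ< i+k+1<N
  a≡i+1+k : toℕ a ≡ i + suc k
  a≡i+1+k = trans (toℕ-fromℕ< i+k+1<N) (trans (+-assoc i k 1) (cong (i +_) (+-comm k 1)))
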